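{- Let $\alpha$ and $N$ be relatively prime natural numbers such that $\alpha-1$ divides $N$, and let $$S_1=\min\left\{\alpha,\left\lfloor \frac{N}{\alpha+1}\right\rfloor\right\},\qquad S_2=\left\lfloor\frac{\alpha-1}{2}\right\rfloor .$$ Then there is a permutation $\pi$ of $\{1,\ldots,N\}$ such that: (a) for all $i,j\in\{1,\ldots,N\}$ with $i\neq j$ and $|(i-j)\bmod N|\le S_1$, one has $|(\pi(i)-\pi(j))\bmod N|\ge S_1$; and (b) for all $i\in\{1,\ldots,N\}$, $|(i-\pi(i))\bmod N|\ge S_2$.
   Context: For an integer $x$, $|x \bmod N|$ denotes the cyclic distance of $x$ from $0$ modulo $N$, i.e. $\min\{r,\,N-r\}$ where $r\in\{0,1,\ldots,N-1\}$ is the residue of $x$ modulo $N$. -}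

module Defs where

open import Data.Nat using (ℕ; zero; suc; _+_; _∸_; _⊓_; _%_)
open import Data.Fin using (Fin; toℕ)

-- residue of (a - b) modulo N, for naturals a, b < N (in the range used below):
-- computed as (a + (N ∸ b mod N)) mod N, which is the residue of a - b mod N.
-- |x mod N| = min { r , N - r } where r is the residue of x modulo N.
-- For N = 0 the value is irrelevant (no elements exist); we set it to 0.
cycDist : (N : ℕ) → ℕ → ℕ → ℕ
cycDist zero    a b = 0
cycDist (suc n) a b =
  let N = suc n
      r = (a + (N ∸ (b % N))) % N
  in r ⊓ (N ∸ r)

-- |(i - j) mod N| for elements of {1,…,N}, represented by Fin N via i ↦ toℕ i + 1
-- (the shift by 1 does not change differences).
finDist : (N : ℕ) → Fin N → Fin N → ℕ
finDist N i j = cycDist N (toℕ i) (toℕ j)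

{-# OPTIONS --safe #-}
module Submission where

-- The permutation is the affine map x ↦ α x + c on ℤ/N with c = ⌊(α − 1)/2⌋, a bijection since α
-- is invertible modulo N. It multiplies differences by α: if 0 < ‖i − j‖ = s ≤ S₁ then
-- S₁ ≤ α s and α s + S₁ ≤ (α + 1) S₁ ≤ N, so ‖α s‖ ≥ S₁. Its displacement x − π(x) is
-- −(α − 1) x − c ≡ −c modulo α − 1, a divisor of N, and the cyclic norm modulo N dominates the
-- cyclic norm modulo any divisor, so ‖x − π(x)‖ ≥ ‖c mod (α − 1)‖ = c.

open import Defs
open import Data.Nat using (ℕ; _≤_; _⊓_; _/_; _∸_; suc)
open import Data.Nat.Coprimality using (Coprime)
open import Data.Integer using (+_; _-_)
open import Data.Integer.Divisibility using (_∣_)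
open import Data.Fin using (Fin)
open import Data.Fin.Permutation using (Permutation; _⟨$⟩ʳ_)
open import Relation.Binary.PropositionalEquality using (_≢_)
open import Data.Product using (Σ; _×_)

open import Data.Nat using (zero; _+_; _*_; _%_; _<_; z≤n; z<s; pred; NonZero; >-nonZero⁻¹)
open import Data.Nat.Properties
  using ( ≤-trans; ≤-reflexive; <-≤-trans; n≢0⇒n>0; m<n⇒0<n∸m
        ; +-comm; +-assoc; +-identityʳ; *-identityˡ; *-identityʳ; *-comm; *-assoc; *-zeroʳ
        ; +-monoˡ-≤; *-monoʳ-≤; *-monoˡ-≤; m+n≤o⇒m≤o∸n; m+[n∸m]≡n; m∸[m∸n]≡n; ∸-monoʳ-<; <⇒≤
        ; *-distribˡ-+; m<m+n; m⊓n≤m; m⊓n≤n; ⊓-glb; ⊓-comm; ⊓-sel; m≤n⇒m⊓n≡m )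
open import Data.Nat.DivMod
  using ( m%n<n; m%n≤n; m%n≤m; m%n%n≡m%n; n%n≡0; m*n%n≡0; [m+n]%n≡m%n; [m+kn]%n≡m%n
        ; %-distribˡ-+; %-distribˡ-*; m<n⇒m%n≡m; m∣n⇒o%n%m≡o%m; m/n*n≤m )
import Data.Nat.Divisibility as ℕ
open import Data.Nat.Coprimality using (coprime-Bézout)
open import Data.Nat.GCD using (module Bézout)
open import Data.Nat.Tactic.RingSolver using (solve-∀)
open import Data.Fin using (toℕ; fromℕ<)
open import Data.Fin.Properties using (toℕ<n; toℕ-fromℕ<; toℕ-injective)
open import Data.Fin.Permutation using (permutation)
open import Data.Product using (∃-syntax; _,_)
open import Data.Sum using (_⊎_; inj₁; inj₂)
open import Function using (_∘_)
open import Relation.Binary.Core using (_Preserves_⟶_)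
open import Relation.Binary.Structures using (IsEquivalence)
open import Relation.Binary.Bundles using (Setoid)
import Relation.Binary.Reasoning.Setoid
open import Relation.Binary.PropositionalEquality using (_≡_; refl; sym; trans; cong; cong₂; subst; module ≡-Reasoning)
open import Relation.Nullary using (¬_)

module Modulo (m : ℕ) .{{_ : NonZero m}} where

  infix 4 _≈_
  record _≈_ (a b : ℕ) : Set where
    constructor mk≈
    field %≡% : a % m ≡ b % m

  ≈-isEquivalence : IsEquivalence _≈_
  ≈-isEquivalence = record
    { refl  = mk≈ refl
    ; sym   = λ (mk≈ p) → mk≈ (sym p)
    ; trans = λ (mk≈ p) (mk≈ q) → mk≈ (trans p q)
    }

  ≈-setoid : Setoid _ _
  ≈-setoid = record { isEquivalence = ≈-isEquivalence }

  open IsEquivalence ≈-isEquivalence public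
    using () renaming (refl to ≈-refl; sym to ≈-sym; trans to ≈-trans)
  module ≈-Reasoning = Relation.Binary.Reasoning.Setoid ≈-setoid

  ≡⇒≈ : ∀ {a b} → a ≡ b → a ≈ b
  ≡⇒≈ refl = ≈-refl

  ≈⇒≡ : ∀ {a b} → a < m → b < m → a ≈ b → a ≡ b
  ≈⇒≡ a<m b<m (mk≈ p) = trans (sym (m<n⇒m%n≡m a<m)) (trans p (m<n⇒m%n≡m b<m))

  %-≈ : ∀ a → a % m ≈ a
  %-≈ a = mk≈ (m%n%n≡m%n a m)

  %≡0⇒≈0 : ∀ {a} → a % m ≡ 0 → a ≈ 0
  %≡0⇒≈0 p = mk≈ (trans p (sym (m*n%n≡0 0 m)))

  m≈0 : m ≈ 0
  m≈0 = %≡0⇒≈0 (n%n≡0 m)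

  *m≈0 : ∀ a → a * m ≈ 0
  *m≈0 a = %≡0⇒≈0 (m*n%n≡0 a m)

  +-cong : ∀ {a b c d} → a ≈ b → c ≈ d → a + c ≈ b + d
  +-cong {a} {b} {c} {d} (mk≈ p) (mk≈ q) =
    mk≈ (trans (%-distribˡ-+ a c m) (trans (cong₂ (λ x y → (x + y) % m) p q) (sym (%-distribˡ-+ b d m))))

  *-cong : ∀ {a b c d} → a ≈ b → c ≈ d → a * c ≈ b * d
  *-cong {a} {b} {c} {d} (mk≈ p) (mk≈ q) =
    mk≈ (trans (%-distribˡ-* a c m) (trans (cong₂ (λ x y → (x * y) % m) p q) (sym (%-distribˡ-* b d m))))

  +-congˡ : ∀ a {b c} → b ≈ c → a + b ≈ a + c
  +-congˡ a = +-cong (≈-refl {a})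

  +-congʳ : ∀ c {a b} → a ≈ b → a + c ≈ b + c
  +-congʳ c p = +-cong p (≈-refl {c})

  *-congˡ : ∀ k {a b} → a ≈ b → k * a ≈ k * b
  *-congˡ k = *-cong (≈-refl {k})

  -- The representative of a − b used by cycDist, so that finDist m i j is definitionally
  -- ‖ toℕ i ⊖ toℕ j ‖.
  infixl 6 _⊖_
  _⊖_ : ℕ → ℕ → ℕ
  a ⊖ b = a + (m ∸ b % m)

  +-[m∸%]≈0 : ∀ b → b + (m ∸ b % m) ≈ 0
  +-[m∸%]≈0 b = begin
    b + (m ∸ b % m)     ≈⟨ +-congʳ (m ∸ b % m) (≈-sym (%-≈ b)) ⟩
    b % m + (m ∸ b % m) ≡⟨ m+[n∸m]≡n (m%n≤n b m) ⟩
    m                   ≈⟨ m≈0 ⟩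
    0                   ∎
    where open ≈-Reasoning

  ⊖-+ : ∀ a b → a ⊖ b + b ≈ a
  ⊖-+ a b = begin
    a + (m ∸ b % m) + b   ≡⟨ +-assoc a _ b ⟩
    a + (m ∸ b % m + b)   ≡⟨ cong (_+_ a) (+-comm _ b) ⟩
    a + (b + (m ∸ b % m)) ≈⟨ +-congˡ a (+-[m∸%]≈0 b) ⟩
    a + 0                 ≡⟨ +-identityʳ a ⟩
    a                     ∎
    where open ≈-Reasoning

  +-⊖ : ∀ a b → a + b ⊖ b ≈ a
  +-⊖ a b = begin
    a + b + (m ∸ b % m)   ≡⟨ +-assoc a b _ ⟩
    a + (b + (m ∸ b % m)) ≈⟨ +-congˡ a (+-[m∸%]≈0 b) ⟩
    a + 0                 ≡⟨ +-identityʳ a ⟩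
    a                     ∎
    where open ≈-Reasoning

  +-cancelʳ : ∀ {a b} c → a + c ≈ b + c → a ≈ b
  +-cancelʳ {a} {b} c p = begin
    a         ≈⟨ ≈-sym (+-⊖ a c) ⟩
    a + c ⊖ c ≈⟨ +-congʳ (m ∸ c % m) p ⟩
    b + c ⊖ c ≈⟨ +-⊖ b c ⟩
    b         ∎
    where open ≈-Reasoning

  ⊖-unique : ∀ {t a b} → t + b ≈ a → t ≈ a ⊖ b
  ⊖-unique {t} {a} {b} p = +-cancelʳ b (≈-trans p (≈-sym (⊖-+ a b)))

  inverse-of-−1 : ∀ {a} → 1 + a ≈ 0 → pred m * a ≈ 1
  inverse-of-−1 {a} p = begin
    pred m * a                ≈⟨ mk≈ (sym ([m+n]%n≡m%n (pred m * a) m)) ⟩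
    pred m * a + m            ≡⟨ cong (_+_ (pred m * a)) (sym (m+[n∸m]≡n (>-nonZero⁻¹ m))) ⟩
    pred m * a + (1 + pred m) ≡⟨ regroup (pred m) a ⟩
    pred m * (1 + a) + 1      ≈⟨ +-congʳ 1 (*-congˡ (pred m) p) ⟩
    pred m * 0 + 1            ≡⟨ cong (_+ 1) (*-zeroʳ (pred m)) ⟩
    1                         ∎
    where
    open ≈-Reasoning
    regroup : ∀ p a → p * a + (1 + p) ≡ p * (1 + a) + 1
    regroup = solve-∀

  inverse : ∀ {k} → Coprime k m → ∃[ u ] u * k ≈ 1
  inverse {k} k⊥m with coprime-Bézout k⊥m
  ... | Bézout.+- x y 1+ym≡xk = x , mk≈ (trans (cong (_% m) (sym 1+ym≡xk)) ([m+kn]%n≡m%n 1 y m))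
  ... | Bézout.-+ x y 1+xk≡ym = pred m * x , ≈-trans (≡⇒≈ (*-assoc (pred m) x k)) (inverse-of-−1 (begin
    1 + x * k ≡⟨ 1+xk≡ym ⟩
    y * m     ≈⟨ *m≈0 y ⟩
    0         ∎))
    where open ≈-Reasoning

  ‖_‖ : ℕ → ℕ
  ‖ t ‖ = t % m ⊓ (m ∸ t % m)

  ‖‖-cong : ∀ {a b} → a ≈ b → ‖ a ‖ ≡ ‖ b ‖
  ‖‖-cong (mk≈ p) = cong (λ r → r ⊓ (m ∸ r)) p

  ‖‖-of-< : ∀ {x} → x < m → ‖ x ‖ ≡ x ⊓ (m ∸ x)
  ‖‖-of-< x<m = cong (λ r → r ⊓ (m ∸ r)) (m<n⇒m%n≡m x<m)

  ‖‖≤ : ∀ t → ‖ t ‖ ≤ t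
  ‖‖≤ t = ≤-trans (m⊓n≤m _ _) (m%n≤m t m)

  ‖m∸r‖≡‖r‖ : ∀ {r} → r < m → ‖ m ∸ r ‖ ≡ ‖ r ‖
  ‖m∸r‖≡‖r‖ {zero}  _   = ‖‖-cong m≈0
  ‖m∸r‖≡‖r‖ {suc r} r<m = begin
      ‖ m ∸ suc r ‖                   ≡⟨ ‖‖-of-< (∸-monoʳ-< z<s (<⇒≤ r<m)) ⟩
      (m ∸ suc r) ⊓ (m ∸ (m ∸ suc r)) ≡⟨ cong ((m ∸ suc r) ⊓_) (m∸[m∸n]≡n (<⇒≤ r<m)) ⟩
      (m ∸ suc r) ⊓ suc r             ≡⟨ ⊓-comm _ (suc r) ⟩
      suc r ⊓ (m ∸ suc r)             ≡⟨ ‖‖-of-< r<m ⟨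
      ‖ suc r ‖                       ∎
    where open ≡-Reasoning

  ‖‖-neg : ∀ {a b} → a + b ≈ 0 → ‖ a ‖ ≡ ‖ b ‖
  ‖‖-neg {a} {b} a+b≈0 = begin
    ‖ a ‖           ≡⟨ ‖‖-cong (⊖-unique a+b≈0) ⟩
    ‖ m ∸ b % m ‖   ≡⟨ ‖m∸r‖≡‖r‖ (m%n<n b m) ⟩
    ‖ b % m ‖       ≡⟨ ‖‖-cong (%-≈ b) ⟩
    ‖ b ‖           ∎
    where open ≡-Reasoning

  ‖‖-cases : ∀ t → ‖ t ‖ ≈ t ⊎ ‖ t ‖ + t ≈ 0
  ‖‖-cases t with ⊓-sel (t % m) (m ∸ t % m)
  ... | inj₁ ‖t‖≡r = inj₁ (≈-trans (≡⇒≈ ‖t‖≡r) (%-≈ t))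
  ... | inj₂ ‖t‖≡m∸r = inj₂ (≈-trans (≡⇒≈ (trans (cong (_+ t) ‖t‖≡m∸r) (+-comm _ t))) (+-[m∸%]≈0 t))

  ‖*‖‖‖ : ∀ k t → ‖ k * t ‖ ≡ ‖ k * ‖ t ‖ ‖
  ‖*‖‖‖ k t with ‖‖-cases t
  ... | inj₁ ‖t‖≈t = ‖‖-cong (*-congˡ k (≈-sym ‖t‖≈t))
  ... | inj₂ ‖t‖+t≈0 = ‖‖-neg (begin
    k * t + k * ‖ t ‖ ≡⟨ *-distribˡ-+ k t ‖ t ‖ ⟨
    k * (t + ‖ t ‖)   ≈⟨ *-congˡ k (≈-trans (≡⇒≈ (+-comm t ‖ t ‖)) ‖t‖+t≈0) ⟩
    k * 0             ≡⟨ *-zeroʳ k ⟩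
    0                 ∎)
    where open ≈-Reasoning

  ‖‖-pos : ∀ {t} → ¬ t ≈ 0 → 0 < ‖ t ‖
  ‖‖-pos {t} t≉0 = ⊓-glb (n≢0⇒n>0 (t≉0 ∘ %≡0⇒≈0)) (m<n⇒0<n∸m (m%n<n t m))

  ‖‖-half : ∀ {x} → x * 2 ≤ m → ‖ x ‖ ≡ x
  ‖‖-half {zero}  _    = ‖‖-of-< (>-nonZero⁻¹ m)
  ‖‖-half {suc x} 2x≤m =
    trans (‖‖-of-< (<-≤-trans (m<m+n (suc x) z<s) x+x≤m)) (m≤n⇒m⊓n≡m (m+n≤o⇒m≤o∸n (suc x) x+x≤m))
    where
    x+x≤m : suc x + suc x ≤ m
    x+x≤m = subst (_≤ m) (trans (*-comm (suc x) 2) (cong (_+_ (suc x)) (+-identityʳ (suc x)))) 2x≤m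

  ≤‖*‖ : ∀ {k S t} → S ≤ k → S * suc k ≤ m → ¬ t ≈ 0 → ‖ t ‖ ≤ S → S ≤ ‖ k * t ‖
  ≤‖*‖ {k} {S} {t} S≤k S[1+k]≤m t≉0 ‖t‖≤S = subst (S ≤_) (sym (‖*‖‖‖ k t)) S≤‖ks‖
    where
    S*[1+k]≡k*S+S : ∀ S k → S * suc k ≡ k * S + S
    S*[1+k]≡k*S+S = solve-∀
    s : ℕ
    s = ‖ t ‖
    0<s : 0 < s
    0<s = ‖‖-pos t≉0
    ks+S≤m : k * s + S ≤ m
    ks+S≤m = ≤-trans (+-monoˡ-≤ S (*-monoʳ-≤ k ‖t‖≤S)) (subst (_≤ m) (S*[1+k]≡k*S+S S k) S[1+k]≤m)
    S≤ks : S ≤ k * s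
    S≤ks = ≤-trans S≤k (≤-trans (≤-reflexive (sym (*-identityʳ k))) (*-monoʳ-≤ k 0<s))
    ks<m : k * s < m
    ks<m = <-≤-trans (m<m+n (k * s) (≤-trans 0<s ‖t‖≤S)) ks+S≤m
    S≤‖ks‖ : S ≤ ‖ k * s ‖
    S≤‖ks‖ = subst (S ≤_) (sym (‖‖-of-< ks<m))
               (⊓-glb S≤ks (m+n≤o⇒m≤o∸n S (subst (_≤ m) (+-comm (k * s) S) ks+S≤m)))

  ⊖≈0⇒≈ : ∀ {a b} → a ⊖ b ≈ 0 → a ≈ b
  ⊖≈0⇒≈ {a} {b} p = ≈-trans (≈-sym (⊖-+ a b)) (+-congʳ b p)

  ⊖-affine : ∀ {k c a b x y} → x ≈ k * a + c → y ≈ k * b + c → x ⊖ y ≈ k * (a ⊖ b)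
  ⊖-affine {k} {c} {a} {b} {x} {y} x≈ka+c y≈kb+c = ≈-sym (⊖-unique (begin
    k * (a ⊖ b) + y           ≈⟨ +-congˡ (k * (a ⊖ b)) y≈kb+c ⟩
    k * (a ⊖ b) + (k * b + c) ≡⟨ +-assoc (k * (a ⊖ b)) (k * b) c ⟨
    k * (a ⊖ b) + k * b + c   ≡⟨ cong (_+ c) (*-distribˡ-+ k (a ⊖ b) b) ⟨
    k * (a ⊖ b + b) + c       ≈⟨ +-congʳ c (*-congˡ k (⊖-+ a b)) ⟩
    k * a + c                 ≈⟨ ≈-sym x≈ka+c ⟩
    x                         ∎))
    where open ≈-Reasoning

  affine-separation : ∀ {k c S a b x y} → S ≤ k → S * suc k ≤ m →
                      x ≈ k * a + c → y ≈ k * b + c → ¬ a ≈ b → ‖ a ⊖ b ‖ ≤ S → S ≤ ‖ x ⊖ y ‖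
  affine-separation {k} {c} {S} {a} {b} S≤k S[1+k]≤m x≈ y≈ a≉b ‖a⊖b‖≤S =
    subst (S ≤_) (sym (‖‖-cong (⊖-affine {k} {c} {a} {b} x≈ y≈))) (≤‖*‖ S≤k S[1+k]≤m (a≉b ∘ ⊖≈0⇒≈) ‖a⊖b‖≤S)

  reduce : ℕ → Fin m
  reduce x = fromℕ< (m%n<n x m)

  toℕ-reduce : ∀ x → toℕ (reduce x) ≈ x
  toℕ-reduce x = ≈-trans (≡⇒≈ (toℕ-fromℕ< (m%n<n x m))) (%-≈ x)

  toℕ-≈-injective : ∀ {i j : Fin m} → toℕ i ≈ toℕ j → i ≡ j
  toℕ-≈-injective {i} {j} = toℕ-injective ∘ ≈⇒≡ (toℕ<n i) (toℕ<n j)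

  residuePermutation : (f g : ℕ → ℕ) → f Preserves _≈_ ⟶ _≈_ → g Preserves _≈_ ⟶ _≈_ →
                       (∀ y → f (g y) ≈ y) → (∀ x → g (f x) ≈ x) → Permutation m m
  residuePermutation f g f-cong g-cong f∘g≈id g∘f≈id =
    permutation (reduce ∘ f ∘ toℕ) (reduce ∘ g ∘ toℕ) (inverse-on-Fin {f} {g} f-cong f∘g≈id) (inverse-on-Fin {g} {f} g-cong g∘f≈id)
    where
    inverse-on-Fin : ∀ {f g} → f Preserves _≈_ ⟶ _≈_ → (∀ y → f (g y) ≈ y) →
                     ∀ j → reduce (f (toℕ (reduce (g (toℕ j))))) ≡ j
    inverse-on-Fin {f} f-cong f∘g≈id j =
      toℕ-≈-injective (≈-trans (toℕ-reduce _) (≈-trans (f-cong (toℕ-reduce _)) (f∘g≈id (toℕ j))))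

  affinePermutation : (k c : ℕ) → ∃[ u ] u * k ≈ 1 → Permutation m m
  affinePermutation k c (u , uk≈1) =
    residuePermutation (λ x → k * x + c) (λ y → u * (y ⊖ c))
      (+-congʳ c ∘ *-congˡ k) (*-congˡ u ∘ +-congʳ (m ∸ c % m)) affine∘unaffine unaffine∘affine
    where
    open ≈-Reasoning
    affine∘unaffine : ∀ y → k * (u * (y ⊖ c)) + c ≈ y
    affine∘unaffine y = begin
      k * (u * (y ⊖ c)) + c ≡⟨ cong (_+ c) (*-assoc k u (y ⊖ c)) ⟨
      k * u * (y ⊖ c) + c   ≡⟨ cong (λ v → v * (y ⊖ c) + c) (*-comm k u) ⟩
      u * k * (y ⊖ c) + c   ≈⟨ +-congʳ c (*-cong uk≈1 ≈-refl) ⟩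
      1 * (y ⊖ c) + c       ≡⟨ cong (_+ c) (*-identityˡ (y ⊖ c)) ⟩
      y ⊖ c + c             ≈⟨ ⊖-+ y c ⟩
      y                     ∎
    unaffine∘affine : ∀ x → u * (k * x + c ⊖ c) ≈ x
    unaffine∘affine x = begin
      u * (k * x + c ⊖ c) ≈⟨ *-congˡ u (+-⊖ (k * x) c) ⟩
      u * (k * x)         ≡⟨ *-assoc u k x ⟨
      u * k * x           ≈⟨ *-cong uk≈1 ≈-refl ⟩
      1 * x               ≡⟨ *-identityˡ x ⟩
      x                   ∎

  affinePermutation-≈ : ∀ k c u i → toℕ (affinePermutation k c u ⟨$⟩ʳ i) ≈ k * toℕ i + c
  affinePermutation-≈ k c u i = toℕ-reduce (k * toℕ i + c)

module _ {d m : ℕ} .{{_ : NonZero d}} .{{_ : NonZero m}} (d∣m : d ℕ.∣ m) where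
  private
    module D = Modulo d
    module M = Modulo m

  ≈-∣ : ∀ {a b} → a M.≈ b → a D.≈ b
  ≈-∣ {a} {b} (M.mk≈ p) =
    D.mk≈ (trans (sym (m∣n⇒o%n%m≡o%m d m a d∣m)) (trans (cong (_% d) p) (m∣n⇒o%n%m≡o%m d m b d∣m)))

  ‖‖-mono-∣ : ∀ t → D.‖ t ‖ ≤ M.‖ t ‖
  ‖‖-mono-∣ t = ⊓-glb
    (≤-trans (≤-reflexive (D.‖‖-cong (≈-∣ (M.≈-sym (M.%-≈ t))))) (D.‖‖≤ (t % m)))
    (≤-trans (≤-reflexive (D.‖‖-neg (≈-∣ (M.+-[m∸%]≈0 t)))) (D.‖‖≤ (m ∸ t % m)))

  affine-displacement-∣ : ∀ {k c a x} → k D.≈ 1 → x M.≈ k * a + c → D.‖ c ‖ ≤ M.‖ a M.⊖ x ‖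
  affine-displacement-∣ {k} {c} {a} {x} k≈1 x≈ka+c = subst (_≤ M.‖ t ‖) (D.‖‖-neg t+c≈0) (‖‖-mono-∣ t)
    where
    t : ℕ
    t = a M.⊖ x
    open D.≈-Reasoning
    t+c≈0 : t + c D.≈ 0
    t+c≈0 = D.+-cancelʳ a (begin
      t + c + a       ≡⟨ +-assoc t c a ⟩
      t + (c + a)     ≡⟨ cong (_+_ t) (+-comm c a) ⟩
      t + (a + c)     ≡⟨ cong (λ v → t + (v + c)) (*-identityˡ a) ⟨
      t + (1 * a + c) ≈⟨ D.+-congˡ t (D.+-congʳ c (D.*-cong (D.≈-sym k≈1) (D.≈-refl {a}))) ⟩
      t + (k * a + c) ≈⟨ ≈-∣ (M.+-congˡ t (M.≈-sym x≈ka+c)) ⟩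
      t + x           ≈⟨ ≈-∣ (M.⊖-+ a x) ⟩
      a               ∎)

module _ {m : ℕ} .{{_ : NonZero m}} where
  open Modulo m

  affine-displacement : ∀ α {a x} → (+ α - + 1) ∣ (+ m) → x ≈ α * a + (α ∸ 1) / 2 → (α ∸ 1) / 2 ≤ ‖ a ⊖ x ‖
  -- For α ≥ 2 the integer hypothesis is definitionally (α − 1) ∣ m in ℕ.
  affine-displacement 0             _     _ = z≤n
  affine-displacement 1             _     _ = z≤n
  affine-displacement (suc (suc d)) {a} {x} d+1∣m x≈ =
    subst (_≤ ‖ a ⊖ x ‖) (Modulo.‖‖-half (suc d) (m/n*n≤m (suc d) 2))
      (affine-displacement-∣ d+1∣m {suc (suc d)} {suc d / 2} {a} {x} (Modulo.mk≈ ([m+n]%n≡m%n 1 (suc d))) x≈)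

theorem1 : (α N : ℕ) → Coprime α N → (+ α - + 1) ∣ (+ N) →
    Σ (Permutation N N) λ π →
      ((i j : Fin N) → i ≢ j → finDist N i j ≤ α ⊓ (N / suc α) →
        α ⊓ (N / suc α) ≤ finDist N (π ⟨$⟩ʳ i) (π ⟨$⟩ʳ j))
      × ((i : Fin N) → (α ∸ 1) / 2 ≤ finDist N i (π ⟨$⟩ʳ i))
theorem1 α zero    _   _     = permutation (λ ()) (λ ()) (λ ()) (λ ()) , (λ ()) , (λ ())
theorem1 α N@(suc _) α⊥N α-1∣N = π , separated , displaced
  where
  open Modulo N

  S c : ℕ
  S = α ⊓ (N / suc α)
  c = (α ∸ 1) / 2

  α⁻¹ : ∃[ u ] u * α ≈ 1
  α⁻¹ = inverse α⊥N

  π : Permutation N N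
  π = affinePermutation α c α⁻¹

  S*[1+α]≤N : S * suc α ≤ N
  S*[1+α]≤N = ≤-trans (*-monoˡ-≤ (suc α) (m⊓n≤n α (N / suc α))) (m/n*n≤m N (suc α))

  separated : ∀ i j → i ≢ j → finDist N i j ≤ S → S ≤ finDist N (π ⟨$⟩ʳ i) (π ⟨$⟩ʳ j)
  separated i j i≢j = affine-separation (m⊓n≤m α (N / suc α)) S*[1+α]≤N
    (affinePermutation-≈ α c α⁻¹ i) (affinePermutation-≈ α c α⁻¹ j) (i≢j ∘ toℕ-≈-injective)

  displaced : ∀ i → c ≤ finDist N i (π ⟨$⟩ʳ i)
  displaced i = affine-displacement α α-1∣N (affinePermutation-≈ α c α⁻¹ i)
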